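{- Let $\varphi$ be a pattern and $x,y$ element variables such that $x$ is free for $y$ in $\varphi$. Then $\vdash_{\mathcal{MG}^c}\forall x\varphi\to\mathrm{Subf}_x^y\varphi$.
   Context: Fix a countably infinite set $EVar$ of element variables and a set $\Sigma$ of constant symbols containing a distinguished "definedness symbol" $\lceil\,\rceil$. Patterns: $\varphi::= x\mid \sigma\mid \bot\mid \neg\varphi\mid \varphi\to\varphi\mid \varphi\wedge\varphi\mid\varphi\vee\varphi\mid \varphi\cdot\varphi\mid \forall x\varphi\mid\exists x\varphi$ ($\varphi\cdot\psi$ is application). Abbreviations: $\varphi\leftrightarrow\psi:=(\varphi\to\psi)\wedge(\psi\to\varphi)$, $\lceil\varphi\rceil:=\lceil\,\rceil\cdot\varphi$, $\lfloor\varphi\rfloor:=\neg\lceil\neg\varphi\rceil$, $\varphi=\psi:=\lfloor\varphi\leftrightarrow\psi\rfloor$. An occurrence of $x$ is bound if inside a subpattern $\forall x\theta$ or $\exists x\theta$, otherwise free. $\mathrm{Subf}_x^y\varphi$ is the result of replacing every free occurrence of $x$ in $\varphi$ by $y$; "$x$ is free for $y$ in $\varphi$" means no free occurrence of $x$ in $\varphi$ lies inside a subpattern of the form $\forall y\theta$ or $\exists y\theta$. $\vdash\psi$ means there is a finite sequence ending in $\psi$ of axiom instances or consequences of earlier members by rules. Proof system $\mathcal{MG}^c$. Axioms: $\varphi\vee\varphi\to\varphi$; $\varphi\to\varphi\wedge\varphi$; $\varphi\to\varphi\vee\psi$; $\varphi\wedge\psi\to\varphi$; $\varphi\vee\psi\to\psi\vee\varphi$;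 $\varphi\wedge\psi\to\psi\wedge\varphi$; $\bot\to\varphi$; $\varphi\vee\neg\varphi$; $\neg\varphi\to(\varphi\to\bot)$; $(\varphi\to\bot)\to\neg\varphi$; $\forall x(\varphi\to\psi)\to(\forall x\varphi\to\forall x\psi)$; $\varphi\to\forall x\varphi$ if $x$ does not occur in $\varphi$; $\exists x(x=y)$ for $y$ distinct from $x$; $\exists x\varphi\to\neg\forall x\neg\varphi$; $\neg\forall x\neg\varphi\to\exists x\varphi$; $(\varphi\vee\psi)\cdot\chi\to\varphi\cdot\chi\vee\psi\cdot\chi$; $\chi\cdot(\varphi\vee\psi)\to\chi\cdot\varphi\vee\chi\cdot\psi$; $(\exists x\varphi)\cdot\psi\to\exists x(\varphi\cdot\psi)$ and $\psi\cdot(\exists x\varphi)\to\exists x(\psi\cdot\varphi)$ if $x$ does not occur in $\psi$; $\lceil\varphi\rceil\cdot\psi\to\lceil\varphi\rceil$; $\psi\cdot\lceil\varphi\rceil\to\lceil\varphi\rceil$; $\lceil x\rceil$; $\varphi\to\lceil\varphi\rceil$; $\lceil\bot\rceil\to\bot$. Rules: from $\varphi$, $\varphi\to\psi$ infer $\psi$; from $\varphi\to\psi$, $\psi\to\chi$ infer $\varphi\to\chi$; from $\varphi\wedge\psi\to\chi$ infer $\varphi\to(\psi\to\chi)$; from $\varphi\to(\psi\to\chi)$ infer $\varphi\wedge\psi\to\chi$; from $\varphi\to\psi$ infer $\chi\vee\varphi\to\chi\vee\psi$; from $\varphi$ infer $\forall x\varphi$; from $\varphi\to\psi$ infer $\varphi\cdot\chi\to\psi\cdot\chi$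 and $\chi\cdot\varphi\to\chi\cdot\psi$. -}

module Defs where

open import Data.Nat using (ℕ; _≟_)
open import Data.Empty using (⊥)
open import Data.Unit using (⊤)
open import Data.Sum using (_⊎_)
open import Data.Product using (_×_)
open import Relation.Nullary using (¬_; yes; no)
open import Relation.Binary.PropositionalEquality using (_≡_)

EVar : Set
EVar = ℕ

-- Patterns over a set Sym of constant symbols.
-- The distinguished definedness symbol is passed as a parameter where needed.
data Pattern (Sym : Set) : Set where
  var  : EVar → Pattern Sym
  sym  : Sym → Pattern Sym
  bot  : Pattern Sym
  neg  : Pattern Sym → Pattern Sym
  _⇒_  : Pattern Sym → Pattern Sym → Pattern Sym
  _∧_  : Pattern Sym → Pattern Sym → Pattern Sym
  _∨_  : Pattern Sym → Pattern Sym → Pattern Sym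
  _·_  : Pattern Sym → Pattern Sym → Pattern Sym
  all  : EVar → Pattern Sym → Pattern Sym
  ex   : EVar → Pattern Sym → Pattern Sym

infixr 4 _⇒_
infixr 6 _∧_
infixr 5 _∨_
infixl 8 _·_

module _ {Sym : Set} where

  Occurs : EVar → Pattern Sym → Set
  Occurs x (var z)   = x ≡ z
  Occurs x (sym s)   = ⊥
  Occurs x bot       = ⊥
  Occurs x (neg φ)   = Occurs x φ
  Occurs x (φ ⇒ ψ)   = Occurs x φ ⊎ Occurs x ψ
  Occurs x (φ ∧ ψ)   = Occurs x φ ⊎ Occurs x ψ
  Occurs x (φ ∨ ψ)   = Occurs x φ ⊎ Occurs x ψ
  Occurs x (φ · ψ)   = Occurs x φ ⊎ Occurs x ψ
  Occurs x (all z φ) = x ≡ z ⊎ Occurs x φ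
  Occurs x (ex z φ)  = x ≡ z ⊎ Occurs x φ

  FreeIn : EVar → Pattern Sym → Set
  FreeIn x (var z)   = x ≡ z
  FreeIn x (sym s)   = ⊥
  FreeIn x bot       = ⊥
  FreeIn x (neg φ)   = FreeIn x φ
  FreeIn x (φ ⇒ ψ)   = FreeIn x φ ⊎ FreeIn x ψ
  FreeIn x (φ ∧ ψ)   = FreeIn x φ ⊎ FreeIn x ψ
  FreeIn x (φ ∨ ψ)   = FreeIn x φ ⊎ FreeIn x ψ
  FreeIn x (φ · ψ)   = FreeIn x φ ⊎ FreeIn x ψ
  FreeIn x (all z φ) = ¬ (x ≡ z) × FreeIn x φ
  FreeIn x (ex z φ)  = ¬ (x ≡ z) × FreeIn x φ

  FreeFor : EVar → EVar → Pattern Sym → Set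
  FreeFor x y (var z)   = ⊤
  FreeFor x y (sym s)   = ⊤
  FreeFor x y bot       = ⊤
  FreeFor x y (neg φ)   = FreeFor x y φ
  FreeFor x y (φ ⇒ ψ)   = FreeFor x y φ × FreeFor x y ψ
  FreeFor x y (φ ∧ ψ)   = FreeFor x y φ × FreeFor x y ψ
  FreeFor x y (φ ∨ ψ)   = FreeFor x y φ × FreeFor x y ψ
  FreeFor x y (φ · ψ)   = FreeFor x y φ × FreeFor x y ψ
  FreeFor x y (all z φ) with x ≟ z
  ... | yes _ = ⊤
  ... | no  _ = (z ≡ y → ¬ FreeIn x φ) × FreeFor x y φ
  FreeFor x y (ex z φ) with x ≟ z
  ... | yes _ = ⊤
  ... | no  _ = (z ≡ y → ¬ FreeIn x φ) × FreeFor x y φ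

  Subf : EVar → EVar → Pattern Sym → Pattern Sym
  Subf x y (var z) with x ≟ z
  ... | yes _ = var y
  ... | no  _ = var z
  Subf x y (sym s)   = sym s
  Subf x y bot       = bot
  Subf x y (neg φ)   = neg (Subf x y φ)
  Subf x y (φ ⇒ ψ)   = Subf x y φ ⇒ Subf x y ψ
  Subf x y (φ ∧ ψ)   = Subf x y φ ∧ Subf x y ψ
  Subf x y (φ ∨ ψ)   = Subf x y φ ∨ Subf x y ψ
  Subf x y (φ · ψ)   = Subf x y φ · Subf x y ψ
  Subf x y (all z φ) with x ≟ z
  ... | yes _ = all z φ
  ... | no  _ = all z (Subf x y φ)
  Subf x y (ex z φ) with x ≟ z
  ... | yes _ = ex z φ
  ... | no  _ = ex z (Subf x y φ)

module Abbrev {Sym : Set} (d : Sym) where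
  _⇔_ : Pattern Sym → Pattern Sym → Pattern Sym
  φ ⇔ ψ = (φ ⇒ ψ) ∧ (ψ ⇒ φ)

  ⌈_⌉ : Pattern Sym → Pattern Sym
  ⌈ φ ⌉ = sym d · φ

  ⌊_⌋ : Pattern Sym → Pattern Sym
  ⌊ φ ⌋ = neg ⌈ neg φ ⌉

  _≐_ : Pattern Sym → Pattern Sym → Pattern Sym
  φ ≐ ψ = ⌊ φ ⇔ ψ ⌋

data ⊢ {Sym : Set} (d : Sym) : Pattern Sym → Set where
  ax-∨idem  : ∀ φ → ⊢ d (φ ∨ φ ⇒ φ)
  ax-∧dup   : ∀ φ → ⊢ d (φ ⇒ φ ∧ φ)
  ax-∨intro : ∀ φ ψ → ⊢ d (φ ⇒ φ ∨ ψ)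
  ax-∧elim  : ∀ φ ψ → ⊢ d (φ ∧ ψ ⇒ φ)
  ax-∨comm  : ∀ φ ψ → ⊢ d (φ ∨ ψ ⇒ ψ ∨ φ)
  ax-∧comm  : ∀ φ ψ → ⊢ d (φ ∧ ψ ⇒ ψ ∧ φ)
  ax-⊥      : ∀ φ → ⊢ d (bot ⇒ φ)
  ax-lem    : ∀ φ → ⊢ d (φ ∨ neg φ)
  ax-¬⇒     : ∀ φ → ⊢ d (neg φ ⇒ (φ ⇒ bot))
  ax-⇒¬     : ∀ φ → ⊢ d ((φ ⇒ bot) ⇒ neg φ)
  ax-∀⇒     : ∀ x φ ψ → ⊢ d (all x (φ ⇒ ψ) ⇒ (all x φ ⇒ all x ψ))
  ax-gen    : ∀ x φ → ¬ Occurs x φ → ⊢ d (φ ⇒ all x φ)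
  ax-ex=    : ∀ x y → ¬ (y ≡ x) → ⊢ d (ex x (Abbrev._≐_ d (var x) (var y)))
  ax-∃⇒¬∀¬  : ∀ x φ → ⊢ d (ex x φ ⇒ neg (all x (neg φ)))
  ax-¬∀¬⇒∃  : ∀ x φ → ⊢ d (neg (all x (neg φ)) ⇒ ex x φ)
  ax-prop∨l : ∀ φ ψ χ → ⊢ d ((φ ∨ ψ) · χ ⇒ φ · χ ∨ ψ · χ)
  ax-prop∨r : ∀ φ ψ χ → ⊢ d (χ · (φ ∨ ψ) ⇒ χ · φ ∨ χ · ψ)
  ax-prop∃l : ∀ x φ ψ → ¬ Occurs x ψ → ⊢ d ((ex x φ) · ψ ⇒ ex x (φ · ψ))
  ax-prop∃r : ∀ x φ ψ → ¬ Occurs x ψ → ⊢ d (ψ · (ex x φ) ⇒ ex x (ψ · φ))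
  ax-⌈⌉l    : ∀ φ ψ → ⊢ d (Abbrev.⌈_⌉ d φ · ψ ⇒ Abbrev.⌈_⌉ d φ)
  ax-⌈⌉r    : ∀ φ ψ → ⊢ d (ψ · Abbrev.⌈_⌉ d φ ⇒ Abbrev.⌈_⌉ d φ)
  ax-⌈x⌉    : ∀ x → ⊢ d (Abbrev.⌈_⌉ d (var x))
  ax-⌈⌉intro : ∀ φ → ⊢ d (φ ⇒ Abbrev.⌈_⌉ d φ)
  ax-⌈⊥⌉    : ⊢ d (Abbrev.⌈_⌉ d bot ⇒ bot)
  mp        : ∀ {φ ψ} → ⊢ d φ → ⊢ d (φ ⇒ ψ) → ⊢ d ψ
  syll      : ∀ {φ ψ χ} → ⊢ d (φ ⇒ ψ) → ⊢ d (ψ ⇒ χ) → ⊢ d (φ ⇒ χ)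
  exp       : ∀ {φ ψ χ} → ⊢ d (φ ∧ ψ ⇒ χ) → ⊢ d (φ ⇒ (ψ ⇒ χ))
  imp       : ∀ {φ ψ χ} → ⊢ d (φ ⇒ (ψ ⇒ χ)) → ⊢ d (φ ∧ ψ ⇒ χ)
  ∨mono     : ∀ {φ ψ} χ → ⊢ d (φ ⇒ ψ) → ⊢ d (χ ∨ φ ⇒ χ ∨ ψ)
  gen       : ∀ {φ} x → ⊢ d φ → ⊢ d (all x φ)
  frameL    : ∀ {φ ψ} χ → ⊢ d (φ ⇒ ψ) → ⊢ d (φ · χ ⇒ ψ · χ)
  frameR    : ∀ {φ ψ} χ → ⊢ d (φ ⇒ ψ) → ⊢ d (χ · φ ⇒ χ · ψ)

{-# OPTIONS --safe #-}
module Submission where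

open import Defs
open import Data.Nat using (ℕ; zero; suc; _≤_; _<_; _⊔_; s≤s; _≟_)
open import Data.Nat.Properties
  using (≤-refl; ≤-reflexive; <⇒≤; m≤n⇒m≤n⊔o; m≤n⇒m≤o⊔n; m⊔n≤o⇒m≤o; m⊔n≤o⇒n≤o; 1+n≰n; ≟-diag)
open import Data.Empty using (⊥-elim)
open import Data.Unit using (⊤; tt)
open import Data.Sum as Sum using (_⊎_; inj₁; inj₂; [_,_]′)
open import Data.Product using (_×_; _,_; proj₁; proj₂; swap; map; map₂; zip′)
open import Function using (_∘_; id)
open import Relation.Nullary using (¬_; yes; no)
open import Relation.Binary.PropositionalEquality
  using (_≡_; _≢_; ≢-sym; refl; trans; cong; cong₂; subst) renaming (sym to ≡-sym)

-- For x ≢ y the axiom ∃x (x ≐ y) gives ∀x φ ⇒ ∃x φ[y/x]: under the hypothesis x ≐ y the patterns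
-- φ and φ[y/x] are interderivable (x ≐ y is a ⌊_⌋-pattern, so it passes through application
-- contexts, and x being free for y lets it pass through binders). Since x is not free in φ[y/x]
-- the ∃x can then be dropped, but the axiom ψ ⇒ ∀x ψ needs x not to occur in ψ at all, so the
-- binders of x are first renamed to fresh variables. Renaming ∀x θ to ∀w θ[w/x] and back is an
-- instance of the theorem for θ itself, so the argument is an induction on quantifier depth.
-- For x ≡ y, rename x to a fresh w and instantiate w back to x.

module Syntax {Sym : Set} where

  private
    P : Set
    P = Pattern Sym

  depth : P → ℕ
  depth (var _)   = 0
  depth (sym _)   = 0
  depth bot       = 0
  depth (neg φ)   = depth φ
  depth (φ ⇒ ψ)   = depth φ ⊔ depth ψ
  depth (φ ∧ ψ)   = depth φ ⊔ depth ψ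
  depth (φ ∨ ψ)   = depth φ ⊔ depth ψ
  depth (φ · ψ)   = depth φ ⊔ depth ψ
  depth (all _ φ) = suc (depth φ)
  depth (ex _ φ)  = suc (depth φ)

  maxVar : P → ℕ
  maxVar (var z)   = z
  maxVar (sym _)   = 0
  maxVar bot       = 0
  maxVar (neg φ)   = maxVar φ
  maxVar (φ ⇒ ψ)   = maxVar φ ⊔ maxVar ψ
  maxVar (φ ∧ ψ)   = maxVar φ ⊔ maxVar ψ
  maxVar (φ ∨ ψ)   = maxVar φ ⊔ maxVar ψ
  maxVar (φ · ψ)   = maxVar φ ⊔ maxVar ψ
  maxVar (all z φ) = z ⊔ maxVar φ
  maxVar (ex z φ)  = z ⊔ maxVar φ

  ≤-⊔ : ∀ {v m n} → v ≤ m ⊎ v ≤ n → v ≤ m ⊔ n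
  ≤-⊔ = [ m≤n⇒m≤n⊔o _ , m≤n⇒m≤o⊔n _ ]′

  Occurs⇒≤maxVar : ∀ {v} (φ : P) → Occurs v φ → v ≤ maxVar φ
  Occurs⇒≤maxVar (var z)   = ≤-reflexive
  Occurs⇒≤maxVar (neg φ)   = Occurs⇒≤maxVar φ
  Occurs⇒≤maxVar (φ ⇒ ψ)   = ≤-⊔ ∘ Sum.map (Occurs⇒≤maxVar φ) (Occurs⇒≤maxVar ψ)
  Occurs⇒≤maxVar (φ ∧ ψ)   = ≤-⊔ ∘ Sum.map (Occurs⇒≤maxVar φ) (Occurs⇒≤maxVar ψ)
  Occurs⇒≤maxVar (φ ∨ ψ)   = ≤-⊔ ∘ Sum.map (Occurs⇒≤maxVar φ) (Occurs⇒≤maxVar ψ)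
  Occurs⇒≤maxVar (φ · ψ)   = ≤-⊔ ∘ Sum.map (Occurs⇒≤maxVar φ) (Occurs⇒≤maxVar ψ)
  Occurs⇒≤maxVar (all z φ) = ≤-⊔ ∘ Sum.map ≤-reflexive (Occurs⇒≤maxVar φ)
  Occurs⇒≤maxVar (ex z φ)  = ≤-⊔ ∘ Sum.map ≤-reflexive (Occurs⇒≤maxVar φ)

  fresh : P → EVar
  fresh φ = suc (maxVar φ)

  ¬Occurs-fresh : ∀ (φ : P) → ¬ Occurs (fresh φ) φ
  ¬Occurs-fresh φ = 1+n≰n ∘ Occurs⇒≤maxVar φ

  depth-Subf : ∀ x y (φ : P) → depth (Subf x y φ) ≡ depth φ
  depth-Subf x y (var z) with x ≟ z
  ... | yes _ = refl
  ... | no  _ = refl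
  depth-Subf x y (sym _)   = refl
  depth-Subf x y bot       = refl
  depth-Subf x y (neg φ)   = depth-Subf x y φ
  depth-Subf x y (φ ⇒ ψ)   = cong₂ _⊔_ (depth-Subf x y φ) (depth-Subf x y ψ)
  depth-Subf x y (φ ∧ ψ)   = cong₂ _⊔_ (depth-Subf x y φ) (depth-Subf x y ψ)
  depth-Subf x y (φ ∨ ψ)   = cong₂ _⊔_ (depth-Subf x y φ) (depth-Subf x y ψ)
  depth-Subf x y (φ · ψ)   = cong₂ _⊔_ (depth-Subf x y φ) (depth-Subf x y ψ)
  depth-Subf x y (all z φ) with x ≟ z
  ... | yes _ = refl
  ... | no  _ = cong suc (depth-Subf x y φ)
  depth-Subf x y (ex z φ) with x ≟ z
  ... | yes _ = refl
  ... | no  _ = cong suc (depth-Subf x y φ)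

  FreeIn⇒Occurs : ∀ x (φ : P) → FreeIn x φ → Occurs x φ
  FreeIn⇒Occurs x (var z)   = id
  FreeIn⇒Occurs x (neg φ)   = FreeIn⇒Occurs x φ
  FreeIn⇒Occurs x (φ ⇒ ψ)   = Sum.map (FreeIn⇒Occurs x φ) (FreeIn⇒Occurs x ψ)
  FreeIn⇒Occurs x (φ ∧ ψ)   = Sum.map (FreeIn⇒Occurs x φ) (FreeIn⇒Occurs x ψ)
  FreeIn⇒Occurs x (φ ∨ ψ)   = Sum.map (FreeIn⇒Occurs x φ) (FreeIn⇒Occurs x ψ)
  FreeIn⇒Occurs x (φ · ψ)   = Sum.map (FreeIn⇒Occurs x φ) (FreeIn⇒Occurs x ψ)
  FreeIn⇒Occurs x (all z φ) = inj₂ ∘ FreeIn⇒Occurs x φ ∘ proj₂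
  FreeIn⇒Occurs x (ex z φ)  = inj₂ ∘ FreeIn⇒Occurs x φ ∘ proj₂

  Subf-¬FreeIn : ∀ x y (φ : P) → ¬ FreeIn x φ → Subf x y φ ≡ φ
  Subf-¬FreeIn x y (var z) x∉φ with x ≟ z
  ... | yes x≡z = ⊥-elim (x∉φ x≡z)
  ... | no  _   = refl
  Subf-¬FreeIn x y (sym _) _     = refl
  Subf-¬FreeIn x y bot _         = refl
  Subf-¬FreeIn x y (neg φ) x∉φ   = cong neg (Subf-¬FreeIn x y φ x∉φ)
  Subf-¬FreeIn x y (φ ⇒ ψ) x∉φψ  =
    cong₂ _⇒_ (Subf-¬FreeIn x y φ (x∉φψ ∘ inj₁)) (Subf-¬FreeIn x y ψ (x∉φψ ∘ inj₂))
  Subf-¬FreeIn x y (φ ∧ ψ) x∉φψ  =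
    cong₂ _∧_ (Subf-¬FreeIn x y φ (x∉φψ ∘ inj₁)) (Subf-¬FreeIn x y ψ (x∉φψ ∘ inj₂))
  Subf-¬FreeIn x y (φ ∨ ψ) x∉φψ  =
    cong₂ _∨_ (Subf-¬FreeIn x y φ (x∉φψ ∘ inj₁)) (Subf-¬FreeIn x y ψ (x∉φψ ∘ inj₂))
  Subf-¬FreeIn x y (φ · ψ) x∉φψ  =
    cong₂ _·_ (Subf-¬FreeIn x y φ (x∉φψ ∘ inj₁)) (Subf-¬FreeIn x y ψ (x∉φψ ∘ inj₂))
  Subf-¬FreeIn x y (all z φ) x∉φ with x ≟ z
  ... | yes _   = refl
  ... | no  x≢z = cong (all z) (Subf-¬FreeIn x y φ (x∉φ ∘ (x≢z ,_)))
  Subf-¬FreeIn x y (ex z φ) x∉φ with x ≟ z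
  ... | yes _   = refl
  ... | no  x≢z = cong (ex z) (Subf-¬FreeIn x y φ (x∉φ ∘ (x≢z ,_)))

  Subf-id : ∀ x (φ : P) → Subf x x φ ≡ φ
  Subf-id x (var z) with x ≟ z
  ... | yes refl = refl
  ... | no  _    = refl
  Subf-id x (sym _)   = refl
  Subf-id x bot       = refl
  Subf-id x (neg φ)   = cong neg (Subf-id x φ)
  Subf-id x (φ ⇒ ψ)   = cong₂ _⇒_ (Subf-id x φ) (Subf-id x ψ)
  Subf-id x (φ ∧ ψ)   = cong₂ _∧_ (Subf-id x φ) (Subf-id x ψ)
  Subf-id x (φ ∨ ψ)   = cong₂ _∨_ (Subf-id x φ) (Subf-id x ψ)
  Subf-id x (φ · ψ)   = cong₂ _·_ (Subf-id x φ) (Subf-id x ψ)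
  Subf-id x (all z φ) with x ≟ z
  ... | yes _ = refl
  ... | no  _ = cong (all z) (Subf-id x φ)
  Subf-id x (ex z φ) with x ≟ z
  ... | yes _ = refl
  ... | no  _ = cong (ex z) (Subf-id x φ)

  Subf-inverse : ∀ x w (φ : P) → ¬ Occurs w φ → Subf w x (Subf x w φ) ≡ φ
  Subf-inverse x w (var z) w∉φ with x ≟ z
  ... | yes x≡z rewrite ≟-diag (refl {x = w}) = cong var x≡z
  ... | no  _ with w ≟ z
  ...   | yes w≡z = ⊥-elim (w∉φ w≡z)
  ...   | no  _   = refl
  Subf-inverse x w (sym _) _     = refl
  Subf-inverse x w bot _         = refl
  Subf-inverse x w (neg φ) w∉φ   = cong neg (Subf-inverse x w φ w∉φ)
  Subf-inverse x w (φ ⇒ ψ) w∉φψ  =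
    cong₂ _⇒_ (Subf-inverse x w φ (w∉φψ ∘ inj₁)) (Subf-inverse x w ψ (w∉φψ ∘ inj₂))
  Subf-inverse x w (φ ∧ ψ) w∉φψ  =
    cong₂ _∧_ (Subf-inverse x w φ (w∉φψ ∘ inj₁)) (Subf-inverse x w ψ (w∉φψ ∘ inj₂))
  Subf-inverse x w (φ ∨ ψ) w∉φψ  =
    cong₂ _∨_ (Subf-inverse x w φ (w∉φψ ∘ inj₁)) (Subf-inverse x w ψ (w∉φψ ∘ inj₂))
  Subf-inverse x w (φ · ψ) w∉φψ  =
    cong₂ _·_ (Subf-inverse x w φ (w∉φψ ∘ inj₁)) (Subf-inverse x w ψ (w∉φψ ∘ inj₂))
  Subf-inverse x w (all z φ) w∉φ with x ≟ z
  ... | yes _ with w ≟ z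
  ...   | yes w≡z = ⊥-elim (w∉φ (inj₁ w≡z))
  ...   | no  _   = cong (all z) (Subf-¬FreeIn w x φ (w∉φ ∘ inj₂ ∘ FreeIn⇒Occurs w φ))
  Subf-inverse x w (all z φ) w∉φ | no _ with w ≟ z
  ...   | yes w≡z = ⊥-elim (w∉φ (inj₁ w≡z))
  ...   | no  _   = cong (all z) (Subf-inverse x w φ (w∉φ ∘ inj₂))
  Subf-inverse x w (ex z φ) w∉φ with x ≟ z
  ... | yes _ with w ≟ z
  ...   | yes w≡z = ⊥-elim (w∉φ (inj₁ w≡z))
  ...   | no  _   = cong (ex z) (Subf-¬FreeIn w x φ (w∉φ ∘ inj₂ ∘ FreeIn⇒Occurs w φ))
  Subf-inverse x w (ex z φ) w∉φ | no _ with w ≟ z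
  ...   | yes w≡z = ⊥-elim (w∉φ (inj₁ w≡z))
  ...   | no  _   = cong (ex z) (Subf-inverse x w φ (w∉φ ∘ inj₂))

  FreeIn-Subf : ∀ x w (φ : P) → FreeIn x (Subf x w φ) → x ≡ w
  FreeIn-Subf x w (var z) with x ≟ z
  ... | yes _   = id
  ... | no  x≢z = ⊥-elim ∘ x≢z
  FreeIn-Subf x w (neg φ) = FreeIn-Subf x w φ
  FreeIn-Subf x w (φ ⇒ ψ) = [ FreeIn-Subf x w φ , FreeIn-Subf x w ψ ]′
  FreeIn-Subf x w (φ ∧ ψ) = [ FreeIn-Subf x w φ , FreeIn-Subf x w ψ ]′
  FreeIn-Subf x w (φ ∨ ψ) = [ FreeIn-Subf x w φ , FreeIn-Subf x w ψ ]′
  FreeIn-Subf x w (φ · ψ) = [ FreeIn-Subf x w φ , FreeIn-Subf x w ψ ]′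
  FreeIn-Subf x w (all z φ) with x ≟ z
  ... | yes x≡z = λ (x≢z , _) → ⊥-elim (x≢z x≡z)
  ... | no  _   = FreeIn-Subf x w φ ∘ proj₂
  FreeIn-Subf x w (ex z φ) with x ≟ z
  ... | yes x≡z = λ (x≢z , _) → ⊥-elim (x≢z x≡z)
  ... | no  _   = FreeIn-Subf x w φ ∘ proj₂

  NoBinder : EVar → P → Set
  NoBinder x (var _)   = ⊤
  NoBinder x (sym _)   = ⊤
  NoBinder x bot       = ⊤
  NoBinder x (neg φ)   = NoBinder x φ
  NoBinder x (φ ⇒ ψ)   = NoBinder x φ × NoBinder x ψ
  NoBinder x (φ ∧ ψ)   = NoBinder x φ × NoBinder x ψ
  NoBinder x (φ ∨ ψ)   = NoBinder x φ × NoBinder x ψ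
  NoBinder x (φ · ψ)   = NoBinder x φ × NoBinder x ψ
  NoBinder x (all z φ) = x ≢ z × NoBinder x φ
  NoBinder x (ex z φ)  = x ≢ z × NoBinder x φ

  ¬Occurs⇒NoBinder : ∀ x (φ : P) → ¬ Occurs x φ → NoBinder x φ
  ¬Occurs⇒NoBinder x (var _)   _ = tt
  ¬Occurs⇒NoBinder x (sym _)   _ = tt
  ¬Occurs⇒NoBinder x bot       _ = tt
  ¬Occurs⇒NoBinder x (neg φ)   x∉φ  = ¬Occurs⇒NoBinder x φ x∉φ
  ¬Occurs⇒NoBinder x (φ ⇒ ψ)   x∉φψ =
    ¬Occurs⇒NoBinder x φ (x∉φψ ∘ inj₁) , ¬Occurs⇒NoBinder x ψ (x∉φψ ∘ inj₂)
  ¬Occurs⇒NoBinder x (φ ∧ ψ)   x∉φψ =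
    ¬Occurs⇒NoBinder x φ (x∉φψ ∘ inj₁) , ¬Occurs⇒NoBinder x ψ (x∉φψ ∘ inj₂)
  ¬Occurs⇒NoBinder x (φ ∨ ψ)   x∉φψ =
    ¬Occurs⇒NoBinder x φ (x∉φψ ∘ inj₁) , ¬Occurs⇒NoBinder x ψ (x∉φψ ∘ inj₂)
  ¬Occurs⇒NoBinder x (φ · ψ)   x∉φψ =
    ¬Occurs⇒NoBinder x φ (x∉φψ ∘ inj₁) , ¬Occurs⇒NoBinder x ψ (x∉φψ ∘ inj₂)
  ¬Occurs⇒NoBinder x (all z φ) x∉φ  = x∉φ ∘ inj₁ , ¬Occurs⇒NoBinder x φ (x∉φ ∘ inj₂)
  ¬Occurs⇒NoBinder x (ex z φ)  x∉φ  = x∉φ ∘ inj₁ , ¬Occurs⇒NoBinder x φ (x∉φ ∘ inj₂)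

  NoBinder-Subf : ∀ v x w (φ : P) → NoBinder v φ → NoBinder v (Subf x w φ)
  NoBinder-Subf v x w (var z) _ with x ≟ z
  ... | yes _ = tt
  ... | no  _ = tt
  NoBinder-Subf v x w (sym _) _ = tt
  NoBinder-Subf v x w bot     _ = tt
  NoBinder-Subf v x w (neg φ) = NoBinder-Subf v x w φ
  NoBinder-Subf v x w (φ ⇒ ψ) = map (NoBinder-Subf v x w φ) (NoBinder-Subf v x w ψ)
  NoBinder-Subf v x w (φ ∧ ψ) = map (NoBinder-Subf v x w φ) (NoBinder-Subf v x w ψ)
  NoBinder-Subf v x w (φ ∨ ψ) = map (NoBinder-Subf v x w φ) (NoBinder-Subf v x w ψ)
  NoBinder-Subf v x w (φ · ψ) = map (NoBinder-Subf v x w φ) (NoBinder-Subf v x w ψ)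
  NoBinder-Subf v x w (all z φ) with x ≟ z
  ... | yes _ = id
  ... | no  _ = map₂ (NoBinder-Subf v x w φ)
  NoBinder-Subf v x w (ex z φ) with x ≟ z
  ... | yes _ = id
  ... | no  _ = map₂ (NoBinder-Subf v x w φ)

  NoBinder⇒Occurs⇒FreeIn : ∀ x (φ : P) → NoBinder x φ → Occurs x φ → FreeIn x φ
  NoBinder⇒Occurs⇒FreeIn x (var z) _ = id
  NoBinder⇒Occurs⇒FreeIn x (neg φ) = NoBinder⇒Occurs⇒FreeIn x φ
  NoBinder⇒Occurs⇒FreeIn x (φ ⇒ ψ) (nφ , nψ) =
    Sum.map (NoBinder⇒Occurs⇒FreeIn x φ nφ) (NoBinder⇒Occurs⇒FreeIn x ψ nψ)
  NoBinder⇒Occurs⇒FreeIn x (φ ∧ ψ) (nφ , nψ) =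
    Sum.map (NoBinder⇒Occurs⇒FreeIn x φ nφ) (NoBinder⇒Occurs⇒FreeIn x ψ nψ)
  NoBinder⇒Occurs⇒FreeIn x (φ ∨ ψ) (nφ , nψ) =
    Sum.map (NoBinder⇒Occurs⇒FreeIn x φ nφ) (NoBinder⇒Occurs⇒FreeIn x ψ nψ)
  NoBinder⇒Occurs⇒FreeIn x (φ · ψ) (nφ , nψ) =
    Sum.map (NoBinder⇒Occurs⇒FreeIn x φ nφ) (NoBinder⇒Occurs⇒FreeIn x ψ nψ)
  NoBinder⇒Occurs⇒FreeIn x (all z φ) (x≢z , nφ) =
    [ ⊥-elim ∘ x≢z , (x≢z ,_) ∘ NoBinder⇒Occurs⇒FreeIn x φ nφ ]′
  NoBinder⇒Occurs⇒FreeIn x (ex z φ) (x≢z , nφ) =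
    [ ⊥-elim ∘ x≢z , (x≢z ,_) ∘ NoBinder⇒Occurs⇒FreeIn x φ nφ ]′

  NoBinder⇒FreeFor : ∀ x y (φ : P) → NoBinder y φ → FreeFor x y φ
  NoBinder⇒FreeFor x y (var _) _ = tt
  NoBinder⇒FreeFor x y (sym _) _ = tt
  NoBinder⇒FreeFor x y bot     _ = tt
  NoBinder⇒FreeFor x y (neg φ) = NoBinder⇒FreeFor x y φ
  NoBinder⇒FreeFor x y (φ ⇒ ψ) = map (NoBinder⇒FreeFor x y φ) (NoBinder⇒FreeFor x y ψ)
  NoBinder⇒FreeFor x y (φ ∧ ψ) = map (NoBinder⇒FreeFor x y φ) (NoBinder⇒FreeFor x y ψ)
  NoBinder⇒FreeFor x y (φ ∨ ψ) = map (NoBinder⇒FreeFor x y φ) (NoBinder⇒FreeFor x y ψ)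
  NoBinder⇒FreeFor x y (φ · ψ) = map (NoBinder⇒FreeFor x y φ) (NoBinder⇒FreeFor x y ψ)
  NoBinder⇒FreeFor x y (all z φ) (y≢z , nφ) with x ≟ z
  ... | yes _ = tt
  ... | no  _ = ⊥-elim ∘ ≢-sym y≢z , NoBinder⇒FreeFor x y φ nφ
  NoBinder⇒FreeFor x y (ex z φ) (y≢z , nφ) with x ≟ z
  ... | yes _ = tt
  ... | no  _ = ⊥-elim ∘ ≢-sym y≢z , NoBinder⇒FreeFor x y φ nφ

  freshen : (EVar → P → P) → EVar → P → P
  freshen Q x φ = Q (fresh (all x φ)) (Subf x (fresh (all x φ)) φ)

  renameBinders : EVar → P → P
  renameBinders x (var z)   = var z
  renameBinders x (sym s)   = sym s
  renameBinders x bot       = bot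
  renameBinders x (neg φ)   = neg (renameBinders x φ)
  renameBinders x (φ ⇒ ψ)   = renameBinders x φ ⇒ renameBinders x ψ
  renameBinders x (φ ∧ ψ)   = renameBinders x φ ∧ renameBinders x ψ
  renameBinders x (φ ∨ ψ)   = renameBinders x φ ∨ renameBinders x ψ
  renameBinders x (φ · ψ)   = renameBinders x φ · renameBinders x ψ
  renameBinders x (all z φ) with x ≟ z
  ... | yes _ = freshen all x (renameBinders x φ)
  ... | no  _ = all z (renameBinders x φ)
  renameBinders x (ex z φ) with x ≟ z
  ... | yes _ = freshen ex x (renameBinders x φ)
  ... | no  _ = ex z (renameBinders x φ)

  depth-renameBinders : ∀ x (φ : P) → depth (renameBinders x φ) ≡ depth φ
  depth-renameBinders x (var _) = refl
  depth-renameBinders x (sym _) = refl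
  depth-renameBinders x bot     = refl
  depth-renameBinders x (neg φ) = depth-renameBinders x φ
  depth-renameBinders x (φ ⇒ ψ) = cong₂ _⊔_ (depth-renameBinders x φ) (depth-renameBinders x ψ)
  depth-renameBinders x (φ ∧ ψ) = cong₂ _⊔_ (depth-renameBinders x φ) (depth-renameBinders x ψ)
  depth-renameBinders x (φ ∨ ψ) = cong₂ _⊔_ (depth-renameBinders x φ) (depth-renameBinders x ψ)
  depth-renameBinders x (φ · ψ) = cong₂ _⊔_ (depth-renameBinders x φ) (depth-renameBinders x ψ)
  depth-renameBinders x (all z φ) with x ≟ z
  ... | yes _ = cong suc (trans (depth-Subf x _ (renameBinders x φ)) (depth-renameBinders x φ))
  ... | no  _ = cong suc (depth-renameBinders x φ)
  depth-renameBinders x (ex z φ) with x ≟ z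
  ... | yes _ = cong suc (trans (depth-Subf x _ (renameBinders x φ)) (depth-renameBinders x φ))
  ... | no  _ = cong suc (depth-renameBinders x φ)

  ≢-fresh : ∀ x (φ : P) → x ≢ fresh (all x φ)
  ≢-fresh x φ x≡w = ¬Occurs-fresh (all x φ) (inj₁ (≡-sym x≡w))

  NoBinder-renameBinders : ∀ x (φ : P) → NoBinder x (renameBinders x φ)
  NoBinder-renameBinders x (var _) = tt
  NoBinder-renameBinders x (sym _) = tt
  NoBinder-renameBinders x bot     = tt
  NoBinder-renameBinders x (neg φ) = NoBinder-renameBinders x φ
  NoBinder-renameBinders x (φ ⇒ ψ) = NoBinder-renameBinders x φ , NoBinder-renameBinders x ψ
  NoBinder-renameBinders x (φ ∧ ψ) = NoBinder-renameBinders x φ , NoBinder-renameBinders x ψ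
  NoBinder-renameBinders x (φ ∨ ψ) = NoBinder-renameBinders x φ , NoBinder-renameBinders x ψ
  NoBinder-renameBinders x (φ · ψ) = NoBinder-renameBinders x φ , NoBinder-renameBinders x ψ
  NoBinder-renameBinders x (all z φ) with x ≟ z
  ... | yes _ = ≢-fresh x φ̃ , NoBinder-Subf x x _ φ̃ (NoBinder-renameBinders x φ)
    where φ̃ = renameBinders x φ
  ... | no x≢z = x≢z , NoBinder-renameBinders x φ
  NoBinder-renameBinders x (ex z φ) with x ≟ z
  ... | yes _ = ≢-fresh x φ̃ , NoBinder-Subf x x _ φ̃ (NoBinder-renameBinders x φ)
    where φ̃ = renameBinders x φ
  ... | no x≢z = x≢z , NoBinder-renameBinders x φ

  FreeIn-renameBinders : ∀ x (φ : P) → FreeIn x (renameBinders x φ) → FreeIn x φ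
  FreeIn-renameBinders x (var _) = id
  FreeIn-renameBinders x (neg φ) = FreeIn-renameBinders x φ
  FreeIn-renameBinders x (φ ⇒ ψ) = Sum.map (FreeIn-renameBinders x φ) (FreeIn-renameBinders x ψ)
  FreeIn-renameBinders x (φ ∧ ψ) = Sum.map (FreeIn-renameBinders x φ) (FreeIn-renameBinders x ψ)
  FreeIn-renameBinders x (φ ∨ ψ) = Sum.map (FreeIn-renameBinders x φ) (FreeIn-renameBinders x ψ)
  FreeIn-renameBinders x (φ · ψ) = Sum.map (FreeIn-renameBinders x φ) (FreeIn-renameBinders x ψ)
  FreeIn-renameBinders x (all z φ) with x ≟ z
  ... | yes _ = λ (x≢w , f) → ⊥-elim (x≢w (FreeIn-Subf x _ (renameBinders x φ) f))
  ... | no  _ = map₂ (FreeIn-renameBinders x φ)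
  FreeIn-renameBinders x (ex z φ) with x ≟ z
  ... | yes _ = λ (x≢w , f) → ⊥-elim (x≢w (FreeIn-Subf x _ (renameBinders x φ) f))
  ... | no  _ = map₂ (FreeIn-renameBinders x φ)

module Derivations {Sym : Set} (d : Sym) where

  open Syntax {Sym}
  open Abbrev d using (⌈_⌉; ⌊_⌋; _≐_)

  private
    P : Set
    P = Pattern Sym

    variable
      A A′ B B′ C Γ : P

  ⇒-refl : ⊢ d (A ⇒ A)
  ⇒-refl {A} = syll (ax-∧dup A) (ax-∧elim A A)

  ∧-fst : ⊢ d (A ∧ B ⇒ A)
  ∧-fst {A} {B} = ax-∧elim A B

  ∧-snd : ⊢ d (A ∧ B ⇒ B)
  ∧-snd {A} {B} = syll (ax-∧comm A B) (ax-∧elim B A)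

  const : ⊢ d A → ⊢ d (B ⇒ A)
  const a = mp a (exp ∧-fst)

  -- A derivation of Γ ⇒ A is used as a natural-deduction judgement with hypotheses Γ, a
  -- left-nested conjunction; ∧-snd and hyp₁ below are its first two hypotheses.
  weaken : ⊢ d (Γ ⇒ A) → ⊢ d (Γ ∧ B ⇒ A)
  weaken = syll ∧-fst

  ∧-mapˡ : ⊢ d (A ⇒ B) → ⊢ d (A ∧ C ⇒ B ∧ C)
  ∧-mapˡ f = imp (syll f (exp ⇒-refl))

  ⟨_,_⟩ : ⊢ d (Γ ⇒ A) → ⊢ d (Γ ⇒ B) → ⊢ d (Γ ⇒ A ∧ B)
  ⟨_,_⟩ {Γ} f g =
    syll (ax-∧dup Γ) (syll (∧-mapˡ f) (syll (ax-∧comm _ Γ) (syll (∧-mapˡ g) (ax-∧comm _ _))))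

  apply : ⊢ d (Γ ⇒ (A ⇒ B)) → ⊢ d (Γ ⇒ A) → ⊢ d (Γ ⇒ B)
  apply f a = syll ⟨ f , a ⟩ (imp ⇒-refl)

  hyp₁ : ⊢ d ((Γ ∧ A) ∧ B ⇒ A)
  hyp₁ = weaken ∧-snd

  ∨-injˡ : ⊢ d (Γ ⇒ A) → ⊢ d (Γ ⇒ A ∨ B)
  ∨-injˡ {B = B} a = syll a (ax-∨intro _ B)

  ∨-injʳ : ⊢ d (Γ ⇒ B) → ⊢ d (Γ ⇒ A ∨ B)
  ∨-injʳ {A = A} b = syll b (syll (ax-∨intro _ A) (ax-∨comm _ A))

  ∨-elim : ⊢ d (A ⇒ C) → ⊢ d (B ⇒ C) → ⊢ d (A ∨ B ⇒ C)
  ∨-elim {A} {C} f g = syll (∨mono A g) (syll (ax-∨comm A C) (syll (∨mono C f) (ax-∨idem C)))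

  flip : ⊢ d (A ⇒ (B ⇒ C)) → ⊢ d (B ⇒ (A ⇒ C))
  flip h = exp (apply (apply (const h) ∧-snd) ∧-fst)

  case : ⊢ d (Γ ⇒ A ∨ B) → ⊢ d (Γ ∧ A ⇒ C) → ⊢ d (Γ ∧ B ⇒ C) → ⊢ d (Γ ⇒ C)
  case s l r = apply (syll s (∨-elim (flip (exp l)) (flip (exp r)))) ⇒-refl

  bot-elim : ⊢ d (Γ ⇒ bot) → ⊢ d (Γ ⇒ A)
  bot-elim {A = A} b = syll b (ax-⊥ A)

  ¬-intro : ⊢ d (Γ ∧ A ⇒ bot) → ⊢ d (Γ ⇒ neg A)
  ¬-intro {A = A} h = syll (exp h) (ax-⇒¬ A)

  ¬-elim : ⊢ d (Γ ⇒ neg A) → ⊢ d (Γ ⇒ A) → ⊢ d (Γ ⇒ bot)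
  ¬-elim {A = A} n a = apply (syll n (ax-¬⇒ A)) a

  excluded-middle : ⊢ d (Γ ⇒ A ∨ neg A)
  excluded-middle {A = A} = const (ax-lem A)

  ¬¬-elim : ⊢ d (neg (neg A) ⇒ A)
  ¬¬-elim = case excluded-middle ∧-snd (bot-elim (¬-elim ∧-fst ∧-snd))

  contraposition : ⊢ d (A ⇒ B) → ⊢ d (neg B ⇒ neg A)
  contraposition f = ¬-intro (¬-elim ∧-fst (syll ∧-snd f))

  ⇒-mono : ⊢ d (A′ ⇒ A) → ⊢ d (B ⇒ B′) → ⊢ d ((A ⇒ B) ⇒ (A′ ⇒ B′))
  ⇒-mono f g = exp (syll (apply ∧-fst (syll ∧-snd f)) g)

  ∧-mono : ⊢ d (A ⇒ A′) → ⊢ d (B ⇒ B′) → ⊢ d (A ∧ B ⇒ A′ ∧ B′)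
  ∧-mono f g = ⟨ syll ∧-fst f , syll ∧-snd g ⟩

  ∨-mono : ⊢ d (A ⇒ A′) → ⊢ d (B ⇒ B′) → ⊢ d (A ∨ B ⇒ A′ ∨ B′)
  ∨-mono f g = ∨-elim (∨-injˡ f) (∨-injʳ g)

  ·-mono : ⊢ d (A ⇒ A′) → ⊢ d (B ⇒ B′) → ⊢ d (A · B ⇒ A′ · B′)
  ·-mono f g = syll (frameL _ f) (frameR _ g)

  trans-under : ⊢ d (Γ ⇒ (A ⇒ B)) → ⊢ d (Γ ⇒ (B ⇒ C)) → ⊢ d (Γ ⇒ (A ⇒ C))
  trans-under f g = exp (apply (weaken g) (apply (weaken f) ∧-snd))

  ¬-mono-under : ⊢ d (Γ ⇒ (B ⇒ A)) → ⊢ d (Γ ⇒ (neg A ⇒ neg B))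
  ¬-mono-under h = exp (¬-intro (¬-elim hyp₁ (apply (weaken (weaken h)) ∧-snd)))

  ⇒-mono-under : ⊢ d (Γ ⇒ (A′ ⇒ A)) → ⊢ d (Γ ⇒ (B ⇒ B′)) → ⊢ d (Γ ⇒ ((A ⇒ B) ⇒ (A′ ⇒ B′)))
  ⇒-mono-under f g =
    exp (exp (apply (weaken (weaken g)) (apply hyp₁ (apply (weaken (weaken f)) ∧-snd))))

  ∧-mono-under : ⊢ d (Γ ⇒ (A ⇒ A′)) → ⊢ d (Γ ⇒ (B ⇒ B′)) → ⊢ d (Γ ⇒ (A ∧ B ⇒ A′ ∧ B′))
  ∧-mono-under f g =
    exp ⟨ apply (weaken f) (syll ∧-snd ∧-fst) , apply (weaken g) (syll ∧-snd ∧-snd) ⟩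

  ∨-mono-under : ⊢ d (Γ ⇒ (A ⇒ A′)) → ⊢ d (Γ ⇒ (B ⇒ B′)) → ⊢ d (Γ ⇒ (A ∨ B ⇒ A′ ∨ B′))
  ∨-mono-under f g = exp (case ∧-snd (∨-injˡ (apply (weaken (weaken f)) ∧-snd))
                                     (∨-injʳ (apply (weaken (weaken g)) ∧-snd)))

  -- A hypothesis ⌊ N ⌋ = neg ⌈ neg N ⌉ survives framing because ⌈ neg N ⌉ absorbs application
  -- contexts: A ⇒ B ∨ ⌈ neg N ⌉ frames to A · C ⇒ B · C ∨ ⌈ neg N ⌉ · C ⇒ B · C ∨ ⌈ neg N ⌉.
  private
    case-split : ⊢ d (neg C ⇒ (A ⇒ B)) → ⊢ d (A ⇒ B ∨ C)
    case-split h =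
      case excluded-middle (∨-injʳ ∧-snd) (∨-injˡ (apply (apply (const h) ∧-snd) ∧-fst))

    resolve : ⊢ d (B ∨ C ⇒ (neg C ⇒ B))
    resolve = ∨-elim (exp ∧-fst) (exp (bot-elim (¬-elim ∧-snd ∧-fst)))

  ·-monoˡ-under : ∀ {N} → ⊢ d (⌊ N ⌋ ⇒ (A ⇒ A′)) → ⊢ d (⌊ N ⌋ ⇒ (A · B ⇒ A′ · B))
  ·-monoˡ-under {A′ = A′} {B} {N} h = flip (syll (frameL B (case-split h))
    (syll (ax-prop∨l A′ ⌈ neg N ⌉ B) (syll (∨mono (A′ · B) (ax-⌈⌉l (neg N) B)) resolve)))

  ·-monoʳ-under : ∀ {N} → ⊢ d (⌊ N ⌋ ⇒ (B ⇒ B′)) → ⊢ d (⌊ N ⌋ ⇒ (A · B ⇒ A · B′))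
  ·-monoʳ-under {B′ = B′} {A} {N} h = flip (syll (frameR A (case-split h))
    (syll (ax-prop∨r B′ ⌈ neg N ⌉ A) (syll (∨mono (A · B′) (ax-⌈⌉r (neg N) A)) resolve)))

  ·-mono-under : ∀ {N} → ⊢ d (⌊ N ⌋ ⇒ (A ⇒ A′)) → ⊢ d (⌊ N ⌋ ⇒ (B ⇒ B′)) →
                 ⊢ d (⌊ N ⌋ ⇒ (A · B ⇒ A′ · B′))
  ·-mono-under f g = trans-under (·-monoˡ-under f) (·-monoʳ-under g)

  ∀-mono : ∀ x → ⊢ d (A ⇒ B) → ⊢ d (all x A ⇒ all x B)
  ∀-mono {A} {B} x f = mp (gen x f) (ax-∀⇒ x A B)

  ∀-intro : ∀ {w} → ¬ Occurs w Γ → ⊢ d (Γ ⇒ A) → ⊢ d (Γ ⇒ all w A)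
  ∀-intro {Γ} {w = w} w∉Γ h = syll (ax-gen w Γ w∉Γ) (∀-mono w h)

  ∀-mono-under : ∀ z → ¬ Occurs z Γ → ⊢ d (Γ ⇒ (A ⇒ B)) → ⊢ d (Γ ⇒ (all z A ⇒ all z B))
  ∀-mono-under {A = A} {B} z z∉Γ h = syll (∀-intro z∉Γ h) (ax-∀⇒ z A B)

  ∃-mono-under : ∀ z → ¬ Occurs z Γ → ⊢ d (Γ ⇒ (A ⇒ B)) → ⊢ d (Γ ⇒ (ex z A ⇒ ex z B))
  ∃-mono-under {A = A} {B} z z∉Γ h =
    syll (¬-mono-under (∀-mono-under z z∉Γ (¬-mono-under h)))
         (⇒-mono (ax-∃⇒¬∀¬ z A) (ax-¬∀¬⇒∃ z B))

  ∃-dual : ∀ x w → ⊢ d (all w (neg B) ⇒ all x (neg A)) → ⊢ d (ex x A ⇒ ex w B)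
  ∃-dual {B} {A} x w h = syll (ax-∃⇒¬∀¬ x A) (syll (contraposition h) (ax-¬∀¬⇒∃ w B))

  ∃-mono : ∀ x → ⊢ d (A ⇒ B) → ⊢ d (ex x A ⇒ ex x B)
  ∃-mono x f = ∃-dual x x (∀-mono x (contraposition f))

  ∃-vacuous : ∀ x → ¬ Occurs x A → ⊢ d (ex x A ⇒ A)
  ∃-vacuous {A} x x∉A = syll (ax-∃⇒¬∀¬ x A) (syll (contraposition (ax-gen x (neg A) x∉A)) ¬¬-elim)

  ∀⇒∃ : ∀ x → ⊢ d (ex x C) → ⊢ d (C ⇒ (A ⇒ B)) → ⊢ d (all x A ⇒ ex x B)
  ∀⇒∃ {C} {A} {B} x ∃C h = syll (apply (¬-mono-under ∀A⇒∀¬B⇒∀¬C) (const ¬∀¬C)) (ax-¬∀¬⇒∃ x B)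
    where
    ∀A⇒∀¬B⇒∀¬C : ⊢ d (all x A ⇒ (all x (neg B) ⇒ all x (neg C)))
    ∀A⇒∀¬B⇒∀¬C = syll (∀-mono x (¬-mono-under (flip h))) (ax-∀⇒ x (neg B) (neg C))
    ¬∀¬C : ⊢ d (neg (all x (neg C)))
    ¬∀¬C = mp ∃C (ax-∃⇒¬∀¬ x C)

  ⌊⌋-elim : ⊢ d (⌊ A ⌋ ⇒ A)
  ⌊⌋-elim {A} = syll (contraposition (ax-⌈⌉intro (neg A))) ¬¬-elim

  ¬Occurs-≐ : ∀ {x y z} → z ≢ x → z ≢ y → ¬ Occurs z (var x ≐ var y)
  ¬Occurs-≐ z≢x z≢y = [ (λ ()) , [ [ z≢x , z≢y ]′ , [ z≢y , z≢x ]′ ]′ ]′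

  ≐-Subf : ∀ x y (φ : P) → FreeFor x y φ →
           ⊢ d (var x ≐ var y ⇒ (φ ⇒ Subf x y φ)) × ⊢ d (var x ≐ var y ⇒ (Subf x y φ ⇒ φ))
  ≐-Subf x y (var z) _ with x ≟ z
  ... | yes refl = syll ⌊⌋-elim ∧-fst , syll ⌊⌋-elim ∧-snd
  ... | no  _    = const ⇒-refl , const ⇒-refl
  ≐-Subf x y (sym _) _ = const ⇒-refl , const ⇒-refl
  ≐-Subf x y bot     _ = const ⇒-refl , const ⇒-refl
  ≐-Subf x y (neg φ) ff = swap (map ¬-mono-under ¬-mono-under (≐-Subf x y φ ff))
  ≐-Subf x y (φ ⇒ ψ) (fφ , fψ) =
    zip′ ⇒-mono-under ⇒-mono-under (swap (≐-Subf x y φ fφ)) (≐-Subf x y ψ fψ)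
  ≐-Subf x y (φ ∧ ψ) (fφ , fψ) = zip′ ∧-mono-under ∧-mono-under (≐-Subf x y φ fφ) (≐-Subf x y ψ fψ)
  ≐-Subf x y (φ ∨ ψ) (fφ , fψ) = zip′ ∨-mono-under ∨-mono-under (≐-Subf x y φ fφ) (≐-Subf x y ψ fψ)
  ≐-Subf x y (φ · ψ) (fφ , fψ) = zip′ ·-mono-under ·-mono-under (≐-Subf x y φ fφ) (≐-Subf x y ψ fψ)
  ≐-Subf x y (all z φ) ff with x ≟ z
  ... | yes _ = const ⇒-refl , const ⇒-refl
  ... | no x≢z with z ≟ y
  ...   | yes z≡y rewrite Subf-¬FreeIn x y φ (proj₁ ff z≡y) = const ⇒-refl , const ⇒-refl
  ...   | no  z≢y = map (∀-mono-under z z∉≐) (∀-mono-under z z∉≐) (≐-Subf x y φ (proj₂ ff))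
    where z∉≐ = ¬Occurs-≐ (≢-sym x≢z) z≢y
  ≐-Subf x y (ex z φ) ff with x ≟ z
  ... | yes _ = const ⇒-refl , const ⇒-refl
  ... | no x≢z with z ≟ y
  ...   | yes z≡y rewrite Subf-¬FreeIn x y φ (proj₁ ff z≡y) = const ⇒-refl , const ⇒-refl
  ...   | no  z≢y = map (∃-mono-under z z∉≐) (∃-mono-under z z∉≐) (≐-Subf x y φ (proj₂ ff))
    where z∉≐ = ¬Occurs-≐ (≢-sym x≢z) z≢y

  infix 3 _⊣⊢_
  _⊣⊢_ : P → P → Set
  A ⊣⊢ B = ⊢ d (A ⇒ B) × ⊢ d (B ⇒ A)

  ⊣⊢-trans : A ⊣⊢ B → B ⊣⊢ C → A ⊣⊢ C
  ⊣⊢-trans (f , f⁻¹) (g , g⁻¹) = syll f g , syll g⁻¹ f⁻¹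

  InstantiableBelow : ℕ → Set
  InstantiableBelow n =
    ∀ x y (φ : P) → x ≢ y → depth φ < n → FreeFor x y φ → ⊢ d (all x φ ⇒ Subf x y φ)

  module _ {n} (instantiate< : InstantiableBelow n) where

    instantiate-freshen : ∀ x (φ : P) → depth φ < n → NoBinder x φ → ⊢ d (freshen all x φ ⇒ φ)
    instantiate-freshen x φ φ<n nb =
      subst (λ ψ → ⊢ d (all w φ′ ⇒ ψ)) (Subf-inverse x w φ (w∉ ∘ inj₂))
        (instantiate< w x φ′ (≢-sym (≢-fresh x φ)) φ′<n (NoBinder⇒FreeFor w x φ′ nb′))
      where
      w = fresh (all x φ)
      w∉ = ¬Occurs-fresh (all x φ)
      φ′ = Subf x w φ
      φ′<n = subst (_< n) (≡-sym (depth-Subf x w φ)) φ<n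
      nb′ = NoBinder-Subf x x w φ nb

    ∀-freshen-⊣⊢ : ∀ x (φ : P) → depth φ < n → NoBinder x φ → all x φ ⊣⊢ freshen all x φ
    ∀-freshen-⊣⊢ x φ φ<n nb =
        ∀-intro w∉ (instantiate< x w φ (≢-fresh x φ) φ<n
                      (NoBinder⇒FreeFor x w φ (¬Occurs⇒NoBinder w φ (w∉ ∘ inj₂))))
      , ∀-intro x∉ (instantiate-freshen x φ φ<n nb)
      where
      w = fresh (all x φ)
      w∉ = ¬Occurs-fresh (all x φ)
      x∉ : ¬ Occurs x (freshen all x φ)
      x∉ = [ ≢-fresh x φ , ≢-fresh x φ ∘ FreeIn-Subf x w φ
                           ∘ NoBinder⇒Occurs⇒FreeIn x (Subf x w φ) (NoBinder-Subf x x w φ nb) ]′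

    -- freshen all x (neg φ) and freshen ex x φ bind the same variable, as maxVar ignores neg.
    ∃-freshen-⊣⊢ : ∀ x (φ : P) → depth φ < n → NoBinder x φ → ex x φ ⊣⊢ freshen ex x φ
    ∃-freshen-⊣⊢ x φ φ<n nb = map (∃-dual _ _) (∃-dual _ _) (swap (∀-freshen-⊣⊢ x (neg φ) φ<n nb))

    renameBinders-⊣⊢ : ∀ x (φ : P) → depth φ ≤ n → φ ⊣⊢ renameBinders x φ
    renameBinders-⊣⊢ x (var _) _ = ⇒-refl , ⇒-refl
    renameBinders-⊣⊢ x (sym _) _ = ⇒-refl , ⇒-refl
    renameBinders-⊣⊢ x bot     _ = ⇒-refl , ⇒-refl
    renameBinders-⊣⊢ x (neg φ) φ≤n =
      swap (map contraposition contraposition (renameBinders-⊣⊢ x φ φ≤n))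
    renameBinders-⊣⊢ x (φ ⇒ ψ) φψ≤n = zip′ ⇒-mono ⇒-mono
      (swap (renameBinders-⊣⊢ x φ (m⊔n≤o⇒m≤o _ _ φψ≤n))) (renameBinders-⊣⊢ x ψ (m⊔n≤o⇒n≤o _ _ φψ≤n))
    renameBinders-⊣⊢ x (φ ∧ ψ) φψ≤n = zip′ ∧-mono ∧-mono
      (renameBinders-⊣⊢ x φ (m⊔n≤o⇒m≤o _ _ φψ≤n)) (renameBinders-⊣⊢ x ψ (m⊔n≤o⇒n≤o _ _ φψ≤n))
    renameBinders-⊣⊢ x (φ ∨ ψ) φψ≤n = zip′ ∨-mono ∨-mono
      (renameBinders-⊣⊢ x φ (m⊔n≤o⇒m≤o _ _ φψ≤n)) (renameBinders-⊣⊢ x ψ (m⊔n≤o⇒n≤o _ _ φψ≤n))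
    renameBinders-⊣⊢ x (φ · ψ) φψ≤n = zip′ ·-mono ·-mono
      (renameBinders-⊣⊢ x φ (m⊔n≤o⇒m≤o _ _ φψ≤n)) (renameBinders-⊣⊢ x ψ (m⊔n≤o⇒n≤o _ _ φψ≤n))
    renameBinders-⊣⊢ x (all z φ) φ<n with x ≟ z
    ... | yes refl = ⊣⊢-trans (map (∀-mono x) (∀-mono x) (renameBinders-⊣⊢ x φ (<⇒≤ φ<n)))
                       (∀-freshen-⊣⊢ x φ̃ φ̃<n (NoBinder-renameBinders x φ))
      where
      φ̃ = renameBinders x φ
      φ̃<n = subst (_< n) (≡-sym (depth-renameBinders x φ)) φ<n
    ... | no  _    = map (∀-mono z) (∀-mono z) (renameBinders-⊣⊢ x φ (<⇒≤ φ<n))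
    renameBinders-⊣⊢ x (ex z φ) φ<n with x ≟ z
    ... | yes refl = ⊣⊢-trans (map (∃-mono x) (∃-mono x) (renameBinders-⊣⊢ x φ (<⇒≤ φ<n)))
                       (∃-freshen-⊣⊢ x φ̃ φ̃<n (NoBinder-renameBinders x φ))
      where
      φ̃ = renameBinders x φ
      φ̃<n = subst (_< n) (≡-sym (depth-renameBinders x φ)) φ<n
    ... | no  _    = map (∃-mono z) (∃-mono z) (renameBinders-⊣⊢ x φ (<⇒≤ φ<n))

    ∃-elim-¬FreeIn : ∀ x (φ : P) → depth φ ≤ n → ¬ FreeIn x φ → ⊢ d (ex x φ ⇒ φ)
    ∃-elim-¬FreeIn x φ φ≤n x∉φ = syll (∃-mono x φ⇒φ̃) (syll (∃-vacuous x x∉φ̃) φ̃⇒φ)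
      where
      φ̃ = renameBinders x φ
      φ⇒φ̃ = proj₁ (renameBinders-⊣⊢ x φ φ≤n)
      φ̃⇒φ = proj₂ (renameBinders-⊣⊢ x φ φ≤n)
      x∉φ̃ : ¬ Occurs x φ̃
      x∉φ̃ = x∉φ ∘ FreeIn-renameBinders x φ
                 ∘ NoBinder⇒Occurs⇒FreeIn x φ̃ (NoBinder-renameBinders x φ)

    instantiate-≢ : ∀ x y (φ : P) → x ≢ y → depth φ ≤ n → FreeFor x y φ →
                    ⊢ d (all x φ ⇒ Subf x y φ)
    instantiate-≢ x y φ x≢y φ≤n ff =
      syll (∀⇒∃ x (ax-ex= x y (≢-sym x≢y)) (proj₁ (≐-Subf x y φ ff)))
           (∃-elim-¬FreeIn x (Subf x y φ) φ′≤n (x≢y ∘ FreeIn-Subf x y φ))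
      where φ′≤n = subst (_≤ n) (≡-sym (depth-Subf x y φ)) φ≤n

    instantiate-self : ∀ x (φ : P) → depth φ < n → ⊢ d (all x φ ⇒ φ)
    instantiate-self x φ φ<n =
      syll (∀-mono x φ⇒φ̃)
        (syll (proj₁ (∀-freshen-⊣⊢ x φ̃ φ̃<n nb̃)) (syll (instantiate-freshen x φ̃ φ̃<n nb̃) φ̃⇒φ))
      where
      φ̃ = renameBinders x φ
      φ⇒φ̃ = proj₁ (renameBinders-⊣⊢ x φ (<⇒≤ φ<n))
      φ̃⇒φ = proj₂ (renameBinders-⊣⊢ x φ (<⇒≤ φ<n))
      φ̃<n = subst (_< n) (≡-sym (depth-renameBinders x φ)) φ<n
      nb̃ = NoBinder-renameBinders x φ

  instantiableBelow : ∀ n → InstantiableBelow n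
  instantiableBelow zero    x y φ x≢y ()
  instantiableBelow (suc n) x y φ x≢y (s≤s φ≤n) = instantiate-≢ (instantiableBelow n) x y φ x≢y φ≤n

open Syntax using (depth; Subf-id)
open Derivations using (instantiableBelow; instantiate-≢; instantiate-self)

mainTheorem6 : {Sym : Set} (d : Sym) (φ : Pattern Sym) (x y : EVar) →
    FreeFor x y φ → ⊢ d (all x φ ⇒ Subf x y φ)
mainTheorem6 d φ x y ff with x ≟ y
... | yes refl rewrite Subf-id x φ =
  instantiate-self d (instantiableBelow d (suc (depth φ))) x φ ≤-refl
... | no x≢y = instantiate-≢ d (instantiableBelow d (depth φ)) x y φ x≢y ≤-refl ff
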